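{- Let $D\geq 2$ be a square-free integer, $K=\mathbb{Q}(\sqrt{D})$, and let $u_D$ be as defined in the context. For an integer $d$, the following are equivalent: (i) $d$ is a positive integer such that the square-free part of $(d-1)^2-4$ is equal to $D$; (ii) $\frac{d-1}{2}$ is the rational part of $u_D^r$ for some $r\in\mathbb{N}$.
   Context: Fix the real embedding of $K=\mathbb{Q}(\sqrt D)$ sending $\sqrt D$ to the positive square root of $D$. Let $u_f$ be the fundamental unit of the ring of integers $\mathbb{Z}_K$ which is $>1$ under this embedding. Set $u_D=u_f^2$ if $u_f$ has norm $-1$, and $u_D=u_f$ otherwise (so $u_D$ is the first positive power of $u_f$ of norm $1$). The rational part of an element $a+b\sqrt D$ ($a,b\in\mathbb{Q}$) of $K$ is $a$. $\mathbb{N}$ denotes the positive integers. -}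

module Defs where

open import Data.Nat as ℕ using (ℕ; zero; suc)
open import Data.Integer as ℤ using (ℤ)
open import Data.Rational as ℚ using (ℚ; 0ℚ; 1ℚ; _/_; ½)
open import Data.Product using (_×_; _,_; Σ; ∃; ∃-syntax; proj₁; proj₂)
open import Data.Sum using (_⊎_)
open import Data.Nat.Divisibility using (_∣_)
open import Relation.Binary.PropositionalEquality using (_≡_)

ℤtoℚ : ℤ → ℚ
ℤtoℚ z = z / 1

IsIntegerℚ : ℚ → Set
IsIntegerℚ q = ∃[ z ] q ≡ ℤtoℚ z

-- Square-free integers: no square k² with k ≥ 2 divides n.
-- (In particular 0 is not square-free.)
SquareFreeℤ : ℤ → Set
SquareFreeℤ n = ∀ (k : ℕ) → (k ℕ.* k) ∣ ℤ.∣ n ∣ → k ≡ 1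

SquareFreePartIs : ℤ → ℤ → Set
SquareFreePartIs n s = SquareFreeℤ s × ∃[ m ] (m ≢0 × n ≡ s ℤ.* (m ℤ.* m))
  where
  _≢0 : ℤ → Set
  m ≢0 = m ≡ ℤ.0ℤ → ⊥ where open import Data.Empty using (⊥)

-- Elements of K = ℚ(√D): a pair (a , b) stands for a + b√D.
-- D is a parameter throughout.

K : Set
K = ℚ × ℚ

ratPart : K → ℚ
ratPart = proj₁

oneK : K
oneK = (1ℚ , 0ℚ)

negK : K → K
negK (a , b) = (ℚ.- a , ℚ.- b)

mulK : ℕ → K → K → K
mulK D (a , b) (c , e) =
  (a ℚ.* c ℚ.+ ℤtoℚ (ℤ.+ D) ℚ.* (b ℚ.* e) , a ℚ.* e ℚ.+ b ℚ.* c)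

powK : ℕ → K → ℕ → K
powK D x zero    = oneK
powK D x (suc n) = mulK D x (powK D x n)

normK : ℕ → K → ℚ
normK D (a , b) = a ℚ.* a ℚ.- ℤtoℚ (ℤ.+ D) ℚ.* (b ℚ.* b)

-- a + b√D is an algebraic integer: its characteristic polynomial
-- X² − 2a X + (a² − D b²) has integer coefficients.
InRingOfIntegers : ℕ → K → Set
InRingOfIntegers D x@(a , b) = IsIntegerℚ (a ℚ.+ a) × IsIntegerℚ (normK D x)

IsUnit : ℕ → K → Set
IsUnit D u = InRingOfIntegers D u × ∃[ v ] (InRingOfIntegers D v × mulK D u v ≡ oneK)

-- "b √D > t", for the positive real square root √D (D ≥ 0),
-- written out by sign cases.
SqrtMulGt : ℕ → ℚ → ℚ → Set
SqrtMulGt D b t =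
    (0ℚ ℚ.≤ b × t ℚ.< 0ℚ)
  ⊎ (0ℚ ℚ.≤ b × 0ℚ ℚ.≤ t × t ℚ.* t ℚ.< ℤtoℚ (ℤ.+ D) ℚ.* (b ℚ.* b))
  ⊎ (b ℚ.< 0ℚ × t ℚ.< 0ℚ × ℤtoℚ (ℤ.+ D) ℚ.* (b ℚ.* b) ℚ.< t ℚ.* t)

-- a + b√D > 1 under the real embedding √D ↦ +√D
GreaterThanOne : ℕ → K → Set
GreaterThanOne D (a , b) = SqrtMulGt D b (1ℚ ℚ.- a)

-- u is the fundamental unit of Z_K which is > 1: u is a unit, u > 1,
-- and every unit is ± u^n for some n ∈ ℤ (expressed as v = ±u^n or v·u^n = ±1, n ∈ ℕ).
IsFundamentalUnit : ℕ → K → Set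
IsFundamentalUnit D u =
  IsUnit D u × GreaterThanOne D u ×
  (∀ v → IsUnit D v → ∃[ n ]
     (v ≡ powK D u n ⊎ v ≡ negK (powK D u n)
      ⊎ mulK D v (powK D u n) ≡ oneK ⊎ mulK D v (powK D u n) ≡ negK oneK))

IsUD : ℕ → K → K → Set
IsUD D uf uD = (normK D uf ≡ ℚ.- 1ℚ × uD ≡ mulK D uf uf)
             ⊎ ((normK D uf ≡ ℚ.- 1ℚ → Data.Empty.⊥) × uD ≡ uf)
  where import Data.Empty

{-# OPTIONS --safe #-}
module Submission where

-- If (d − 1)² − 4 = D m² with m ≠ 0, then v = ((d − 1) + m√D)/2 has integral trace and norm 1,
-- so it is a unit. A unit of norm 1 with non-negative rational part is u_D^r or its conjugate,
-- and r ≥ 1 because m ≠ 0; both have rational part (d − 1)/2. Conversely, u_D^r = a + b√D with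
-- a, b > 0 and a² − D b² = 1, so (2a)² − 4 = D (2b)², and 2b is an integer because D is
-- square-free. That a, b > 0 comes from u_f > 1 together with N(u_f) = ±1.

open import Defs
open import Data.Nat as ℕ using (ℕ; zero; suc)
import Data.Nat.Properties as ℕP
open import Data.Nat.Divisibility using (_∣_; divides; ∣-trans)
open import Data.Nat.Coprimality as Coprimality using (Coprime)
open import Data.Integer as ℤ using (ℤ)
import Data.Integer.Properties as ℤP
open import Data.Rational as ℚ using (ℚ; mkℚ; 0ℚ; 1ℚ; ½; _+_; _-_; _*_; -_; _<_; _≤_)
import Data.Rational.Properties as ℚP
import Data.Rational.Unnormalised as ℚᵘ
import Data.Rational.Unnormalised.Properties as ℚᵘP
open import Data.Rational.Solver using (module +-*-Solver)
open +-*-Solver using (solve; _:=_; _:+_; _:-_; _:*_; :-_; con)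
open import Data.Product using (_×_; _,_; proj₁; proj₂; ∃-syntax)
open import Data.Sum as Sum using (_⊎_; inj₁; inj₂)
open import Data.Empty using (⊥; ⊥-elim)
open import Relation.Nullary using (¬_; yes; no)
open import Relation.Binary.Definitions using (tri<; tri≈; tri>)
open import Relation.Binary.PropositionalEquality
open import Function.Bundles using (_⇔_; mk⇔)

ℤtoℚ≡mkℚ : ∀ z → ℤtoℚ z ≡ mkℚ z 0 (Coprimality.sym (Coprimality.1-coprimeTo _))
ℤtoℚ≡mkℚ z = ℚP.↥p/↧p≡p (mkℚ z 0 _)

toℚᵘ-ℤtoℚ : ∀ z → ℚ.toℚᵘ (ℤtoℚ z) ≡ ℚᵘ.mkℚᵘ z 0
toℚᵘ-ℤtoℚ z = cong ℚ.toℚᵘ (ℤtoℚ≡mkℚ z)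

ℤtoℚ-injective : ∀ {z w} → ℤtoℚ z ≡ ℤtoℚ w → z ≡ w
ℤtoℚ-injective {z} {w} eq = cong ℚᵘ.↥_ (trans (sym (toℚᵘ-ℤtoℚ z)) (trans (cong ℚ.toℚᵘ eq) (toℚᵘ-ℤtoℚ w)))

ℤtoℚ-+ : ∀ z w → ℤtoℚ (z ℤ.+ w) ≡ ℤtoℚ z + ℤtoℚ w
ℤtoℚ-+ z w = ℚP.toℚᵘ-injective (begin
  ℚ.toℚᵘ (ℤtoℚ (z ℤ.+ w))                      ≡⟨ toℚᵘ-ℤtoℚ (z ℤ.+ w) ⟩
  ℚᵘ.mkℚᵘ (z ℤ.+ w) 0                           ≈⟨ ℚᵘ.*≡* (cong (ℤ._* ℤ.1ℤ) (cong₂ ℤ._+_ (sym (ℤP.*-identityʳ z)) (sym (ℤP.*-identityʳ w)))) ⟩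
  ℚᵘ.mkℚᵘ z 0 ℚᵘ.+ ℚᵘ.mkℚᵘ w 0                  ≡⟨ sym (cong₂ ℚᵘ._+_ (toℚᵘ-ℤtoℚ z) (toℚᵘ-ℤtoℚ w)) ⟩
  ℚ.toℚᵘ (ℤtoℚ z) ℚᵘ.+ ℚ.toℚᵘ (ℤtoℚ w)          ≈⟨ ℚᵘP.≃-sym (ℚP.toℚᵘ-homo-+ (ℤtoℚ z) (ℤtoℚ w)) ⟩
  ℚ.toℚᵘ (ℤtoℚ z + ℤtoℚ w)                      ∎)
  where open ℚᵘP.≃-Reasoning

ℤtoℚ-* : ∀ z w → ℤtoℚ (z ℤ.* w) ≡ ℤtoℚ z * ℤtoℚ w
ℤtoℚ-* z w = ℚP.toℚᵘ-injective (begin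
  ℚ.toℚᵘ (ℤtoℚ (z ℤ.* w))                      ≡⟨ toℚᵘ-ℤtoℚ (z ℤ.* w) ⟩
  ℚᵘ.mkℚᵘ z 0 ℚᵘ.* ℚᵘ.mkℚᵘ w 0                  ≡⟨ sym (cong₂ ℚᵘ._*_ (toℚᵘ-ℤtoℚ z) (toℚᵘ-ℤtoℚ w)) ⟩
  ℚ.toℚᵘ (ℤtoℚ z) ℚᵘ.* ℚ.toℚᵘ (ℤtoℚ w)          ≈⟨ ℚᵘP.≃-sym (ℚP.toℚᵘ-homo-* (ℤtoℚ z) (ℤtoℚ w)) ⟩
  ℚ.toℚᵘ (ℤtoℚ z * ℤtoℚ w)                      ∎)
  where open ℚᵘP.≃-Reasoning

ℤtoℚ-mono-≤ : ∀ {z w} → z ℤ.≤ w → ℤtoℚ z ≤ ℤtoℚ w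
ℤtoℚ-mono-≤ {z} {w} z≤w = ℚP.toℚᵘ-cancel-≤ (subst₂ ℚᵘ._≤_ (sym (toℚᵘ-ℤtoℚ z)) (sym (toℚᵘ-ℤtoℚ w))
  (ℚᵘ.*≤* (subst₂ ℤ._≤_ (sym (ℤP.*-identityʳ z)) (sym (ℤP.*-identityʳ w)) z≤w)))

ℤtoℚ-cancel-< : ∀ {z w} → ℤtoℚ z < ℤtoℚ w → z ℤ.< w
ℤtoℚ-cancel-< {z} {w} lt with subst₂ ℚᵘ._<_ (toℚᵘ-ℤtoℚ z) (toℚᵘ-ℤtoℚ w) (ℚP.toℚᵘ-mono-< lt)
... | ℚᵘ.*<* z*1<w*1 = subst₂ ℤ._<_ (ℤP.*-identityʳ z) (ℤP.*-identityʳ w) z*1<w*1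

0≤ℤtoℚ+ : ∀ n → 0ℚ ≤ ℤtoℚ (ℤ.+ n)
0≤ℤtoℚ+ n = ℤtoℚ-mono-≤ {ℤ.0ℤ} {ℤ.+ n} (ℤ.+≤+ ℕ.z≤n)

0<d⇒0≤d-1 : ∀ {d} → ℤ.0ℤ ℤ.< d → ℤ.0ℤ ℤ.≤ d ℤ.- ℤ.1ℤ
0<d⇒0≤d-1 {ℤ.+ suc n} _ = ℤ.+≤+ ℕ.z≤n
0<d⇒0≤d-1 {ℤ.+ zero} (ℤ.+<+ ())

0<d-1⇒0<d : ∀ {d} → ℤ.0ℤ ℤ.< d ℤ.- ℤ.1ℤ → ℤ.0ℤ ℤ.< d
0<d-1⇒0<d {ℤ.+ suc n} _ = ℤ.+<+ (ℕ.s≤s ℕ.z≤n)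

i*j≡1⇒i≡±1 : ∀ i j → i ℤ.* j ≡ ℤ.1ℤ → i ≡ ℤ.1ℤ ⊎ i ≡ ℤ.-1ℤ
i*j≡1⇒i≡±1 i j eq with ℕP.m*n≡1⇒m≡1 ℤ.∣ i ∣ ℤ.∣ j ∣ (trans (sym (ℤP.abs-* i j)) (cong ℤ.∣_∣ eq))
i*j≡1⇒i≡±1 (ℤ.+ .1)     j eq | refl = inj₁ refl
i*j≡1⇒i≡±1 ℤ.-[1+ .0 ] j eq | refl = inj₂ refl

-1ℚ : ℚ
-1ℚ = - 1ℚ

≤∧≢⇒< : ∀ {p r} → p ≤ r → p ≢ r → p < r
≤∧≢⇒< {p} {r} p≤r p≢r with ℚP.<-cmp p r
... | tri< p<r _ _ = p<r
... | tri≈ _ p≡r _ = ⊥-elim (p≢r p≡r)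
... | tri> _ _ r<p = ⊥-elim (ℚP.<-irrefl refl (ℚP.≤-<-trans p≤r r<p))

pos*pos : ∀ {p r} → 0ℚ < p → 0ℚ < r → 0ℚ < p * r
pos*pos {p} {r} 0<p 0<r = ℚP.positive⁻¹ _ {{ℚP.pos*pos⇒pos p {{ℚ.positive 0<p}} r {{ℚ.positive 0<r}}}}

nonNeg*nonNeg : ∀ {p r} → 0ℚ ≤ p → 0ℚ ≤ r → 0ℚ ≤ p * r
nonNeg*nonNeg {p} {r} 0≤p 0≤r = ℚP.nonNegative⁻¹ _ {{ℚP.nonNeg*nonNeg⇒nonNeg p {{ℚ.nonNegative 0≤p}} r {{ℚ.nonNegative 0≤r}}}}

square-nonNeg : ∀ p → 0ℚ ≤ p * p
square-nonNeg p with ℚP.≤-total 0ℚ p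
... | inj₁ 0≤p = nonNeg*nonNeg 0≤p 0≤p
... | inj₂ p≤0 = ℚP.nonNegative⁻¹ _ {{ℚP.nonPos*nonPos⇒nonPos p {{ℚ.nonPositive p≤0}} p {{ℚ.nonPositive p≤0}}}}

p<r⇒0<r-p : ∀ {p r} → p < r → 0ℚ < r - p
p<r⇒0<r-p {p} {r} p<r = subst (_< r - p) (ℚP.+-inverseʳ p) (ℚP.+-monoˡ-< (- p) p<r)

p≤r⇒0≤r-p : ∀ {p r} → p ≤ r → 0ℚ ≤ r - p
p≤r⇒0≤r-p {p} {r} p≤r = subst (_≤ r - p) (ℚP.+-inverseʳ p) (ℚP.+-monoˡ-≤ (- p) p≤r)

≡±1⇒≯1 : ∀ {p} → p ≡ 1ℚ ⊎ p ≡ -1ℚ → ¬ (1ℚ < p)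
≡±1⇒≯1 (inj₁ refl) = ℚP.<-irrefl refl
≡±1⇒≯1 (inj₂ refl) (ℚ.*<* ())

≡±1⇒≮-1 : ∀ {p} → p ≡ 1ℚ ⊎ p ≡ -1ℚ → ¬ (p < -1ℚ)
≡±1⇒≮-1 (inj₁ refl) (ℚ.*<* ())
≡±1⇒≮-1 (inj₂ refl) = ℚP.<-irrefl refl

p*½+p*½≡p : ∀ p → p * ½ + p * ½ ≡ p
p*½+p*½≡p = solve 1 (λ p → p :* con ½ :+ p :* con ½ := p) refl

0≤-p⇒p≯0 : ∀ {p} → 0ℚ ≤ - p → ¬ (0ℚ < p)
0≤-p⇒p≯0 0≤-p 0<p = ℚP.<-irrefl refl (ℚP.≤-<-trans 0≤-p (ℚP.neg-antimono-< 0<p))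

-- Arithmetic in K = ℚ(√D)

conjK : K → K
conjK (a , b) = (a , - b)

module _ (D : ℕ) where
  private
    q : ℚ
    q = ℤtoℚ (ℤ.+ D)

  mulK-assoc : ∀ x y z → mulK D (mulK D x y) z ≡ mulK D x (mulK D y z)
  mulK-assoc (a , b) (c , e) (f , g) = cong₂ _,_
    (solve 7 (λ q a b c e f g → (a :* c :+ q :* (b :* e)) :* f :+ q :* ((a :* e :+ b :* c) :* g)
                             := a :* (c :* f :+ q :* (e :* g)) :+ q :* (b :* (c :* g :+ e :* f))) refl q a b c e f g)
    (solve 7 (λ q a b c e f g → (a :* c :+ q :* (b :* e)) :* g :+ (a :* e :+ b :* c) :* f
                             := a :* (c :* g :+ e :* f) :+ b :* (c :* f :+ q :* (e :* g))) refl q a b c e f g)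

  mulK-identityˡ : ∀ x → mulK D oneK x ≡ x
  mulK-identityˡ (a , b) = cong₂ _,_
    (solve 3 (λ q a b → con 1ℚ :* a :+ q :* (con 0ℚ :* b) := a) refl q a b)
    (solve 2 (λ a b → con 1ℚ :* b :+ con 0ℚ :* a := b) refl a b)

  mulK-identityʳ : ∀ x → mulK D x oneK ≡ x
  mulK-identityʳ (a , b) = cong₂ _,_
    (solve 3 (λ q a b → a :* con 1ℚ :+ q :* (b :* con 0ℚ) := a) refl q a b)
    (solve 2 (λ a b → a :* con 0ℚ :+ b :* con 1ℚ := b) refl a b)

  ratPart-mulK-negOneˡ : ∀ x → ratPart (mulK D (negK oneK) x) ≡ - ratPart x
  ratPart-mulK-negOneˡ (a , b) = solve 3 (λ q a b → (:- con 1ℚ) :* a :+ q :* ((:- con 0ℚ) :* b) := :- a) refl q a b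

  normK-mulK : ∀ x y → normK D (mulK D x y) ≡ normK D x * normK D y
  normK-mulK (a , b) (c , e) = solve 5 (λ q a b c e →
      (a :* c :+ q :* (b :* e)) :* (a :* c :+ q :* (b :* e)) :- q :* ((a :* e :+ b :* c) :* (a :* e :+ b :* c))
      := (a :* a :- q :* (b :* b)) :* (c :* c :- q :* (e :* e))) refl q a b c e

  normK-negK : ∀ x → normK D (negK x) ≡ normK D x
  normK-negK (a , b) = solve 3 (λ q a b → (:- a) :* (:- a) :- q :* ((:- b) :* (:- b)) := a :* a :- q :* (b :* b)) refl q a b

  normK-conjK : ∀ x → normK D (conjK x) ≡ normK D x
  normK-conjK (a , b) = solve 3 (λ q a b → a :* a :- q :* ((:- b) :* (:- b)) := a :* a :- q :* (b :* b)) refl q a b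

  normK-oneK : normK D oneK ≡ 1ℚ
  normK-oneK = solve 1 (λ q → con 1ℚ :* con 1ℚ :- q :* (con 0ℚ :* con 0ℚ) := con 1ℚ) refl q

  mulK-conjKʳ : ∀ x → mulK D x (conjK x) ≡ (normK D x , 0ℚ)
  mulK-conjKʳ (a , b) = cong₂ _,_
    (solve 3 (λ q a b → a :* a :+ q :* (b :* (:- b)) := a :* a :- q :* (b :* b)) refl q a b)
    (solve 2 (λ a b → a :* (:- b) :+ b :* a := con 0ℚ) refl a b)

  mulK-conjK-normK≡1 : ∀ x → normK D x ≡ 1ℚ → mulK D x (conjK x) ≡ oneK
  mulK-conjK-normK≡1 x Nx≡1 = trans (mulK-conjKʳ x) (cong (_, 0ℚ) Nx≡1)

  mulK≡⇒≡mulK-conjK : ∀ v x w → normK D x ≡ 1ℚ → mulK D v x ≡ w → v ≡ mulK D w (conjK x)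
  mulK≡⇒≡mulK-conjK v x w Nx≡1 vx≡w = begin
    v                                ≡⟨ sym (mulK-identityʳ v) ⟩
    mulK D v oneK                    ≡⟨ cong (mulK D v) (sym (mulK-conjK-normK≡1 x Nx≡1)) ⟩
    mulK D v (mulK D x (conjK x))    ≡⟨ sym (mulK-assoc v x (conjK x)) ⟩
    mulK D (mulK D v x) (conjK x)    ≡⟨ cong (λ y → mulK D y (conjK x)) vx≡w ⟩
    mulK D w (conjK x)               ∎
    where open ≡-Reasoning

  normK-powK : ∀ x → normK D x ≡ 1ℚ → ∀ n → normK D (powK D x n) ≡ 1ℚ
  normK-powK x Nx≡1 zero    = normK-oneK
  normK-powK x Nx≡1 (suc n) = begin
    normK D (mulK D x (powK D x n))   ≡⟨ normK-mulK x (powK D x n) ⟩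
    normK D x * normK D (powK D x n)  ≡⟨ cong₂ _*_ Nx≡1 (normK-powK x Nx≡1 n) ⟩
    1ℚ * 1ℚ                           ≡⟨⟩
    1ℚ                                ∎
    where open ≡-Reasoning

  normK-cofactor : ∀ v x w → normK D v ≡ 1ℚ → mulK D v x ≡ w → normK D w ≡ 1ℚ → normK D x ≡ 1ℚ
  normK-cofactor v x w Nv≡1 vx≡w Nw≡1 = begin
    normK D x                ≡⟨ sym (ℚP.*-identityˡ (normK D x)) ⟩
    1ℚ * normK D x           ≡⟨ cong (_* normK D x) (sym Nv≡1) ⟩
    normK D v * normK D x    ≡⟨ sym (normK-mulK v x) ⟩
    normK D (mulK D v x)     ≡⟨ cong (normK D) vx≡w ⟩
    normK D w                ≡⟨ Nw≡1 ⟩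
    1ℚ                       ∎
    where open ≡-Reasoning

  powK-even-or-odd : ∀ x n → ∃[ k ] (powK D x n ≡ powK D (mulK D x x) k ⊎ powK D x n ≡ mulK D x (powK D (mulK D x x) k))
  powK-even-or-odd x zero = 0 , inj₁ refl
  powK-even-or-odd x (suc n) with powK-even-or-odd x n
  ... | k , inj₁ even = k , inj₂ (cong (mulK D x) even)
  ... | k , inj₂ odd  = suc k , inj₁ (begin
    mulK D x (powK D x n)                              ≡⟨ cong (mulK D x) odd ⟩
    mulK D x (mulK D x (powK D (mulK D x x) k))        ≡⟨ sym (mulK-assoc x x _) ⟩
    mulK D (mulK D x x) (powK D (mulK D x x) k)        ∎)
    where open ≡-Reasoning

PositiveCoefficients : K → Set
PositiveCoefficients (a , b) = 0ℚ < a × 0ℚ < b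

module _ (D : ℕ) where

  mulK-positive : ∀ {x c e} → PositiveCoefficients x → 0ℚ < c → 0ℚ ≤ e → PositiveCoefficients (mulK D x (c , e))
  mulK-positive {a , b} (0<a , 0<b) 0<c 0≤e =
    ℚP.+-mono-<-≤ (pos*pos 0<a 0<c) (nonNeg*nonNeg (0≤ℤtoℚ+ D) (nonNeg*nonNeg (ℚP.<⇒≤ 0<b) 0≤e)) ,
    ℚP.+-mono-≤-< (nonNeg*nonNeg (ℚP.<⇒≤ 0<a) 0≤e) (pos*pos 0<b 0<c)

  powK-positive : ∀ {x} → PositiveCoefficients x → ∀ n → PositiveCoefficients (powK D x (suc n))
  powK-positive pos zero    = mulK-positive pos (ℚP.positive⁻¹ 1ℚ) ℚP.≤-refl
  powK-positive pos (suc n) = let (0<c , 0<e) = powK-positive pos n in mulK-positive pos 0<c (ℚP.<⇒≤ 0<e)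

  powK-ratPart-positive : ∀ x → PositiveCoefficients x → ∀ n → 0ℚ < ratPart (powK D x n)
  powK-ratPart-positive x pos zero    = ℚP.positive⁻¹ 1ℚ
  powK-ratPart-positive x pos (suc n) = proj₁ (powK-positive {x} pos n)

module _ (D : ℕ) (a b : ℚ) where
  private
    q s : ℚ
    q = ℤtoℚ (ℤ.+ D)
    s = 1ℚ - a

    qb²≡0 : 0ℚ ≡ b → q * (b * b) ≡ 0ℚ
    qb²≡0 refl = ℚP.*-zeroʳ q

  1<normK : s < 0ℚ → q * (b * b) ≤ s * s → 1ℚ < normK D (a , b)
  1<normK s<0 qb²≤s² = begin-strict
    1ℚ                                          <⟨ ℚP.+-monoʳ-< 1ℚ (ℚP.+-mono-≤-< (p≤r⇒0≤r-p qb²≤s²) (ℚP.+-mono-< 0<-s 0<-s)) ⟩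
    1ℚ + ((s * s - q * (b * b)) + (- s + - s))  ≡⟨ solve 3 (λ q a b →
        con 1ℚ :+ (((con 1ℚ :- a) :* (con 1ℚ :- a) :- q :* (b :* b)) :+ ((:- (con 1ℚ :- a)) :+ (:- (con 1ℚ :- a))))
        := a :* a :- q :* (b :* b)) refl q a b ⟩
    normK D (a , b)                             ∎
    where
    open ℚP.≤-Reasoning
    0<-s : 0ℚ < - s
    0<-s = ℚP.neg-antimono-< s<0

  normK<-1 : a ≤ 0ℚ → s * s < q * (b * b) → normK D (a , b) < -1ℚ
  normK<-1 a≤0 s²<qb² = begin-strict
    normK D (a , b)                                ≡⟨ solve 3 (λ q a b →
        a :* a :- q :* (b :* b)
        := (:- con 1ℚ) :+ (:- ((q :* (b :* b) :- (con 1ℚ :- a) :* (con 1ℚ :- a)) :+ ((:- a) :+ (:- a))))) refl q a b ⟩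
    -1ℚ + - ((q * (b * b) - s * s) + (- a + - a))  <⟨ ℚP.+-monoʳ-< -1ℚ (ℚP.neg-antimono-< (ℚP.+-mono-<-≤ (p<r⇒0<r-p s²<qb²) (ℚP.+-mono-≤ 0≤-a 0≤-a))) ⟩
    -1ℚ                                            ∎
    where
    open ℚP.≤-Reasoning
    0≤-a : 0ℚ ≤ - a
    0≤-a = ℚP.neg-antimono-≤ a≤0

  -- Apart from a, b > 0, each sign case of a + b√D > 1 is impossible or forces N > 1 or N < −1.
  greaterThanOne⇒positive : normK D (a , b) ≡ 1ℚ ⊎ normK D (a , b) ≡ -1ℚ → GreaterThanOne D (a , b) →
                            PositiveCoefficients (a , b)
  greaterThanOne⇒positive N≡±1 (inj₁ (0≤b , s<0)) = 0<a , ≤∧≢⇒< 0≤b 0≢b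
    where
    0<a : 0ℚ < a
    0<a = subst (0ℚ <_) (solve 1 (λ a → con 1ℚ :+ (:- (con 1ℚ :- a)) := a) refl a)
                (ℚP.+-mono-< (ℚP.positive⁻¹ 1ℚ) (ℚP.neg-antimono-< s<0))
    0≢b : 0ℚ ≢ b
    0≢b 0≡b = ≡±1⇒≯1 N≡±1 (1<normK s<0 (subst (_≤ s * s) (sym (qb²≡0 0≡b)) (square-nonNeg s)))
  greaterThanOne⇒positive N≡±1 (inj₂ (inj₁ (0≤b , 0≤s , s²<qb²))) = 0<a , ≤∧≢⇒< 0≤b 0≢b
    where
    0<a : 0ℚ < a
    0<a with a ℚP.≤? 0ℚ
    ... | yes a≤0 = ⊥-elim (≡±1⇒≮-1 N≡±1 (normK<-1 a≤0 s²<qb²))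
    ... | no  a≰0 = ℚP.≰⇒> a≰0
    0≢b : 0ℚ ≢ b
    0≢b 0≡b = ℚP.<-irrefl refl (ℚP.≤-<-trans (square-nonNeg s) (subst (s * s <_) (qb²≡0 0≡b) s²<qb²))
  greaterThanOne⇒positive N≡±1 (inj₂ (inj₂ (_ , s<0 , qb²<s²))) = ⊥-elim (≡±1⇒≯1 N≡±1 (1<normK s<0 (ℚP.<⇒≤ qb²<s²)))

-- Square-free D

coprime-square : ∀ {m n} → Coprime m n → Coprime (m ℕ.* m) n
coprime-square {m} {n} m⊥n {i} (i∣mm , i∣n) = m⊥n (Coprimality.coprime-divisor i⊥m i∣mm , i∣n)
  where
  i⊥m : Coprime i m
  i⊥m (j∣i , j∣m) = m⊥n (j∣m , ∣-trans j∣i i∣n)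

squareFree-denominator : ∀ {D n den c} → SquareFreeℤ (ℤ.+ D) → Coprime n den →
                         D ℕ.* (n ℕ.* n) ≡ c ℕ.* (den ℕ.* den) → den ≡ 1
squareFree-denominator {D} {n} {den} {c} sqf n⊥den eq = sqf den den²∣D
  where
  den²∣nnD : den ℕ.* den ∣ n ℕ.* (n ℕ.* D)
  den²∣nnD = divides c (trans (trans (sym (ℕP.*-assoc n n D)) (ℕP.*-comm (n ℕ.* n) D)) eq)
  den²⊥n : Coprime (den ℕ.* den) n
  den²⊥n = coprime-square (Coprimality.sym n⊥den)
  den²∣D : den ℕ.* den ∣ D
  den²∣D = Coprimality.coprime-divisor den²⊥n (Coprimality.coprime-divisor den²⊥n den²∣nnD)

squareFree-integral : ∀ {D} → SquareFreeℤ (ℤ.+ D) → ∀ y k → ℤtoℚ (ℤ.+ D) * (y * y) ≡ ℤtoℚ k → IsIntegerℚ y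
squareFree-integral {D} sqf y@(mkℚ n dm n⊥den) k eq
  with squareFree-denominator {D} {ℤ.∣ n ∣} {suc dm} {ℤ.∣ k ∣} sqf (Coprimality.recompute n⊥den) eqℕ
  where
  eqᵘ : ℚᵘ.mkℚᵘ (ℤ.+ D) 0 ℚᵘ.* (ℚᵘ.mkℚᵘ n dm ℚᵘ.* ℚᵘ.mkℚᵘ n dm) ℚᵘ.≃ ℚᵘ.mkℚᵘ k 0
  eqᵘ = begin
    ℚᵘ.mkℚᵘ (ℤ.+ D) 0 ℚᵘ.* (ℚ.toℚᵘ y ℚᵘ.* ℚ.toℚᵘ y)  ≡⟨ cong (ℚᵘ._* _) (sym (toℚᵘ-ℤtoℚ (ℤ.+ D))) ⟩
    ℚ.toℚᵘ (ℤtoℚ (ℤ.+ D)) ℚᵘ.* (ℚ.toℚᵘ y ℚᵘ.* ℚ.toℚᵘ y) ≈⟨ ℚᵘP.*-congˡ {ℚ.toℚᵘ (ℤtoℚ (ℤ.+ D))} (ℚᵘP.≃-sym (ℚP.toℚᵘ-homo-* y y)) ⟩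
    ℚ.toℚᵘ (ℤtoℚ (ℤ.+ D)) ℚᵘ.* ℚ.toℚᵘ (y * y)          ≈⟨ ℚᵘP.≃-sym (ℚP.toℚᵘ-homo-* (ℤtoℚ (ℤ.+ D)) (y * y)) ⟩
    ℚ.toℚᵘ (ℤtoℚ (ℤ.+ D) * (y * y))                     ≡⟨ cong ℚ.toℚᵘ eq ⟩
    ℚ.toℚᵘ (ℤtoℚ k)                                     ≡⟨ toℚᵘ-ℤtoℚ k ⟩
    ℚᵘ.mkℚᵘ k 0                                         ∎
    where open ℚᵘP.≃-Reasoning
  eqℤ : ℤ.+ D ℤ.* (n ℤ.* n) ℤ.* ℤ.1ℤ ≡ k ℤ.* ℤ.+ (1 ℕ.* (suc dm ℕ.* suc dm))
  eqℤ with eqᵘ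
  ... | ℚᵘ.*≡* e = e
  eqℕ : D ℕ.* (ℤ.∣ n ∣ ℕ.* ℤ.∣ n ∣) ≡ ℤ.∣ k ∣ ℕ.* (suc dm ℕ.* suc dm)
  eqℕ = begin
    D ℕ.* (ℤ.∣ n ∣ ℕ.* ℤ.∣ n ∣)                       ≡⟨ cong (D ℕ.*_) (sym (ℤP.abs-* n n)) ⟩
    D ℕ.* ℤ.∣ n ℤ.* n ∣                               ≡⟨ sym (ℤP.abs-* (ℤ.+ D) (n ℤ.* n)) ⟩
    ℤ.∣ ℤ.+ D ℤ.* (n ℤ.* n) ∣                         ≡⟨ cong ℤ.∣_∣ (sym (ℤP.*-identityʳ (ℤ.+ D ℤ.* (n ℤ.* n)))) ⟩
    ℤ.∣ ℤ.+ D ℤ.* (n ℤ.* n) ℤ.* ℤ.1ℤ ∣                ≡⟨ cong ℤ.∣_∣ eqℤ ⟩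
    ℤ.∣ k ℤ.* ℤ.+ (1 ℕ.* (suc dm ℕ.* suc dm)) ∣       ≡⟨ ℤP.abs-* k _ ⟩
    ℤ.∣ k ∣ ℕ.* (1 ℕ.* (suc dm ℕ.* suc dm))           ≡⟨ cong (ℤ.∣ k ∣ ℕ.*_) (ℕP.*-identityˡ _) ⟩
    ℤ.∣ k ∣ ℕ.* (suc dm ℕ.* suc dm)                   ∎
    where open ≡-Reasoning
... | refl = n , sym (ℤtoℚ≡mkℚ n)

-- Units

module _ (D : ℕ) where

  IsUnit⇒normK≡±1 : ∀ u → IsUnit D u → normK D u ≡ 1ℚ ⊎ normK D u ≡ -1ℚ
  IsUnit⇒normK≡±1 u ((_ , z , Nu≡z) , v , (_ , w , Nv≡w) , uv≡1) =
    Sum.map (λ z≡1 → trans Nu≡z (cong ℤtoℚ z≡1)) (λ z≡-1 → trans Nu≡z (cong ℤtoℚ z≡-1)) (i*j≡1⇒i≡±1 z w zw≡1)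
    where
    zw≡1 : z ℤ.* w ≡ ℤ.1ℤ
    zw≡1 = ℤtoℚ-injective {z ℤ.* w} {ℤ.1ℤ} (begin
      ℤtoℚ (z ℤ.* w)           ≡⟨ ℤtoℚ-* z w ⟩
      ℤtoℚ z * ℤtoℚ w          ≡⟨ sym (cong₂ _*_ Nu≡z Nv≡w) ⟩
      normK D u * normK D v    ≡⟨ sym (normK-mulK D u v) ⟩
      normK D (mulK D u v)     ≡⟨ cong (normK D) uv≡1 ⟩
      normK D oneK             ≡⟨ normK-oneK D ⟩
      1ℚ                       ∎)
      where open ≡-Reasoning

  normK≡1⇒IsUnit : ∀ a b → IsIntegerℚ (a + a) → normK D (a , b) ≡ 1ℚ → IsUnit D (a , b)
  normK≡1⇒IsUnit a b trace N≡1 =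
    (trace , ℤ.1ℤ , N≡1) ,
    conjK (a , b) , (trace , ℤ.1ℤ , trans (normK-conjK D (a , b)) N≡1) , mulK-conjK-normK≡1 D (a , b) N≡1

  ratPart-powK-or-conjK : ∀ v x → proj₂ v ≢ 0ℚ → ∃[ k ] (v ≡ powK D x k ⊎ v ≡ conjK (powK D x k)) →
                          ∃[ r ] (1 ℕ.≤ r × ratPart v ≡ ratPart (powK D x r))
  ratPart-powK-or-conjK v x v₂≢0 (zero  , inj₁ v≡1) = ⊥-elim (v₂≢0 (cong proj₂ v≡1))
  ratPart-powK-or-conjK v x v₂≢0 (zero  , inj₂ v≡1) = ⊥-elim (v₂≢0 (cong proj₂ v≡1))
  ratPart-powK-or-conjK v x v₂≢0 (suc r , inj₁ v≡x) = suc r , ℕ.s≤s ℕ.z≤n , cong proj₁ v≡x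
  ratPart-powK-or-conjK v x v₂≢0 (suc r , inj₂ v≡x) = suc r , ℕ.s≤s ℕ.z≤n , cong proj₁ v≡x

module _ (D : ℕ) (uf : K) (fundamental : IsFundamentalUnit D uf) where

  IsFundamentalUnit⇒normK≡±1 : normK D uf ≡ 1ℚ ⊎ normK D uf ≡ -1ℚ
  IsFundamentalUnit⇒normK≡±1 = IsUnit⇒normK≡±1 D uf (proj₁ fundamental)

  IsFundamentalUnit⇒positive : PositiveCoefficients uf
  IsFundamentalUnit⇒positive =
    greaterThanOne⇒positive D (proj₁ uf) (proj₂ uf) IsFundamentalUnit⇒normK≡±1 (proj₁ (proj₂ fundamental))

module _ (D : ℕ) (uf uD : K) where

  IsUD⇒normK≡1 : normK D uf ≡ 1ℚ ⊎ normK D uf ≡ -1ℚ → IsUD D uf uD → normK D uD ≡ 1ℚ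
  IsUD⇒normK≡1 _ (inj₁ (Nuf≡-1 , uD≡uf²)) = begin
    normK D uD                  ≡⟨ cong (normK D) uD≡uf² ⟩
    normK D (mulK D uf uf)      ≡⟨ normK-mulK D uf uf ⟩
    normK D uf * normK D uf     ≡⟨ cong₂ _*_ Nuf≡-1 Nuf≡-1 ⟩
    -1ℚ * -1ℚ                   ≡⟨⟩
    1ℚ                          ∎
    where open ≡-Reasoning
  IsUD⇒normK≡1 (inj₁ Nuf≡1)  (inj₂ (_ , uD≡uf))  = trans (cong (normK D) uD≡uf) Nuf≡1
  IsUD⇒normK≡1 (inj₂ Nuf≡-1) (inj₂ (Nuf≢-1 , _)) = ⊥-elim (Nuf≢-1 Nuf≡-1)

  IsUD⇒positive : PositiveCoefficients uf → IsUD D uf uD → PositiveCoefficients uD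
  IsUD⇒positive uf-pos (inj₁ (_ , uD≡uf²)) = subst PositiveCoefficients (sym uD≡uf²)
    (mulK-positive D {uf} {proj₁ uf} {proj₂ uf} uf-pos (proj₁ uf-pos) (ℚP.<⇒≤ (proj₂ uf-pos)))
  IsUD⇒positive uf-pos (inj₂ (_ , uD≡uf))  = subst PositiveCoefficients (sym uD≡uf) uf-pos

  IsUD⇒powK-uf≡powK-uD : IsUD D uf uD → normK D uD ≡ 1ℚ → ∀ n → normK D (powK D uf n) ≡ 1ℚ →
                          ∃[ k ] powK D uf n ≡ powK D uD k
  IsUD⇒powK-uf≡powK-uD (inj₂ (_ , uD≡uf)) _ n _ = n , cong (λ u → powK D u n) (sym uD≡uf)
  IsUD⇒powK-uf≡powK-uD (inj₁ (Nuf≡-1 , uD≡uf²)) NuD≡1 n Nufⁿ≡1 with powK-even-or-odd D uf n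
  ... | k , inj₁ even = k , trans even (cong (λ u → powK D u k) (sym uD≡uf²))
  ... | k , inj₂ odd  = ⊥-elim (-1≢1 (begin
    -1ℚ * 1ℚ                                       ≡⟨ sym (cong₂ _*_ Nuf≡-1 (normK-powK D uD NuD≡1 k)) ⟩
    normK D uf * normK D (powK D uD k)             ≡⟨ sym (normK-mulK D uf (powK D uD k)) ⟩
    normK D (mulK D uf (powK D uD k))              ≡⟨ cong (λ u → normK D (mulK D uf (powK D u k))) uD≡uf² ⟩
    normK D (mulK D uf (powK D (mulK D uf uf) k))  ≡⟨ cong (normK D) (sym odd) ⟩
    normK D (powK D uf n)                          ≡⟨ Nufⁿ≡1 ⟩
    1ℚ                                             ∎))
    where
    open ≡-Reasoning
    -1≢1 : -1ℚ * 1ℚ ≢ 1ℚ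
    -1≢1 ()

-- The equation t² − 4 = D m²

ℤtoℚ-square-4 : ∀ t → ℤtoℚ (t ℤ.* t ℤ.- ℤ.+ 4) ≡ ℤtoℚ t * ℤtoℚ t - ℤtoℚ (ℤ.+ 4)
ℤtoℚ-square-4 t = trans (ℤtoℚ-+ (t ℤ.* t) (ℤ.- ℤ.+ 4)) (cong (_- ℤtoℚ (ℤ.+ 4)) (ℤtoℚ-* t t))

ℤtoℚ-D*square : ∀ D m → ℤtoℚ (ℤ.+ D ℤ.* (m ℤ.* m)) ≡ ℤtoℚ (ℤ.+ D) * (ℤtoℚ m * ℤtoℚ m)
ℤtoℚ-D*square D m = trans (ℤtoℚ-* (ℤ.+ D) (m ℤ.* m)) (cong (ℤtoℚ (ℤ.+ D) *_) (ℤtoℚ-* m m))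

halfK : ℤ → ℤ → K
halfK t m = (ℤtoℚ t * ½ , ℤtoℚ m * ½)

module _ (D : ℕ) where
  private
    q : ℚ
    q = ℤtoℚ (ℤ.+ D)

  normK-halfK : ∀ t m → t ℤ.* t ℤ.- ℤ.+ 4 ≡ ℤ.+ D ℤ.* (m ℤ.* m) → normK D (halfK t m) ≡ 1ℚ
  normK-halfK t m pell = begin
    normK D (halfK t m)                                   ≡⟨ solve 3 (λ q T M →
        (T :* con ½) :* (T :* con ½) :- q :* ((M :* con ½) :* (M :* con ½))
        := con 1ℚ :+ con (½ * ½) :* ((T :* T :- con (ℤtoℚ (ℤ.+ 4))) :- q :* (M :* M))) refl q T M ⟩
    1ℚ + ½ * ½ * ((T * T - ℤtoℚ (ℤ.+ 4)) - q * (M * M))  ≡⟨ cong (λ z → 1ℚ + ½ * ½ * (z - q * (M * M))) pellℚ ⟩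
    1ℚ + ½ * ½ * (q * (M * M) - q * (M * M))              ≡⟨ solve 1 (λ z → con 1ℚ :+ con (½ * ½) :* (z :- z) := con 1ℚ) refl (q * (M * M)) ⟩
    1ℚ                                                    ∎
    where
    open ≡-Reasoning
    T M : ℚ
    T = ℤtoℚ t
    M = ℤtoℚ m
    pellℚ : T * T - ℤtoℚ (ℤ.+ 4) ≡ q * (M * M)
    pellℚ = trans (sym (ℤtoℚ-square-4 t)) (trans (cong ℤtoℚ pell) (ℤtoℚ-D*square D m))

  squareFreePart-of-normK≡1 : ∀ a b t → SquareFreeℤ (ℤ.+ D) → normK D (a , b) ≡ 1ℚ → 0ℚ < b →
                              ℤtoℚ t ≡ a + a → SquareFreePartIs (t ℤ.* t ℤ.- ℤ.+ 4) (ℤ.+ D)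
  squareFreePart-of-normK≡1 a b t sqf N≡1 0<b t≡2a = sqf , m , m≢0 , ℤtoℚ-injective {t ℤ.* t ℤ.- ℤ.+ 4} {ℤ.+ D ℤ.* (m ℤ.* m)} pellℚ
    where
    open ≡-Reasoning
    qy²≡ : q * ((b + b) * (b + b)) ≡ ℤtoℚ (t ℤ.* t ℤ.- ℤ.+ 4)
    qy²≡ = begin
      q * ((b + b) * (b + b))                                              ≡⟨ solve 3 (λ q a b →
          q :* ((b :+ b) :* (b :+ b))
          := ((a :+ a) :* (a :+ a) :- con (ℤtoℚ (ℤ.+ 4))) :- con (ℤtoℚ (ℤ.+ 4)) :* ((a :* a :- q :* (b :* b)) :- con 1ℚ)) refl q a b ⟩
      ((a + a) * (a + a) - ℤtoℚ (ℤ.+ 4)) - ℤtoℚ (ℤ.+ 4) * (normK D (a , b) - 1ℚ) ≡⟨ cong (λ N → ((a + a) * (a + a) - ℤtoℚ (ℤ.+ 4)) - ℤtoℚ (ℤ.+ 4) * (N - 1ℚ)) N≡1 ⟩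
      ((a + a) * (a + a) - ℤtoℚ (ℤ.+ 4)) - ℤtoℚ (ℤ.+ 4) * (1ℚ - 1ℚ)       ≡⟨ solve 1 (λ z → z :- con (ℤtoℚ (ℤ.+ 4)) :* (con 1ℚ :- con 1ℚ) := z) refl _ ⟩
      (a + a) * (a + a) - ℤtoℚ (ℤ.+ 4)                                     ≡⟨ cong (λ z → z * z - ℤtoℚ (ℤ.+ 4)) (sym t≡2a) ⟩
      ℤtoℚ t * ℤtoℚ t - ℤtoℚ (ℤ.+ 4)                                       ≡⟨ sym (ℤtoℚ-square-4 t) ⟩
      ℤtoℚ (t ℤ.* t ℤ.- ℤ.+ 4)                                             ∎
    integral : IsIntegerℚ (b + b)
    integral = squareFree-integral {D} sqf (b + b) (t ℤ.* t ℤ.- ℤ.+ 4) qy²≡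
    m : ℤ
    m = proj₁ integral
    m≢0 : m ≢ ℤ.0ℤ
    m≢0 m≡0 = ℚP.<-irrefl (sym (trans (proj₂ integral) (cong ℤtoℚ m≡0))) (ℚP.+-mono-< 0<b 0<b)
    pellℚ : ℤtoℚ (t ℤ.* t ℤ.- ℤ.+ 4) ≡ ℤtoℚ (ℤ.+ D ℤ.* (m ℤ.* m))
    pellℚ = trans (sym qy²≡) (trans (cong (λ y → q * (y * y)) (proj₂ integral)) (sym (ℤtoℚ-D*square D m)))

module _ (D : ℕ) (uf uD : K) (fundamental : IsFundamentalUnit D uf) (ud : IsUD D uf uD) where
  private
    NuD≡1 : normK D uD ≡ 1ℚ
    NuD≡1 = IsUD⇒normK≡1 D uf uD (IsFundamentalUnit⇒normK≡±1 D uf fundamental) ud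
    uD-positive : PositiveCoefficients uD
    uD-positive = IsUD⇒positive D uf uD (IsFundamentalUnit⇒positive D uf fundamental) ud

  unit-of-normK≡1 : ∀ v → IsUnit D v → normK D v ≡ 1ℚ → 0ℚ ≤ ratPart v →
                    ∃[ k ] (v ≡ powK D uD k ⊎ v ≡ conjK (powK D uD k))
  unit-of-normK≡1 v v-unit Nv≡1 0≤v₁ = classify (proj₂ (proj₂ fundamental) v v-unit)
    where
    conj-of-inverse : ∀ n w → mulK D v (powK D uf n) ≡ w → normK D w ≡ 1ℚ →
                      ∃[ k ] v ≡ mulK D w (conjK (powK D uD k))
    conj-of-inverse n w vufⁿ≡w Nw≡1 =
      let k , ufⁿ≡uDᵏ = IsUD⇒powK-uf≡powK-uD D uf uD ud NuD≡1 n (normK-cofactor D v (powK D uf n) w Nv≡1 vufⁿ≡w Nw≡1)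
      in  k , mulK≡⇒≡mulK-conjK D v (powK D uD k) w (normK-powK D uD NuD≡1 k)
                (trans (cong (mulK D v) (sym ufⁿ≡uDᵏ)) vufⁿ≡w)

    classify : ∃[ n ] (v ≡ powK D uf n ⊎ v ≡ negK (powK D uf n)
                 ⊎ mulK D v (powK D uf n) ≡ oneK ⊎ mulK D v (powK D uf n) ≡ negK oneK) →
               ∃[ k ] (v ≡ powK D uD k ⊎ v ≡ conjK (powK D uD k))
    classify (n , inj₁ v≡ufⁿ) =
      let k , ufⁿ≡uDᵏ = IsUD⇒powK-uf≡powK-uD D uf uD ud NuD≡1 n (trans (cong (normK D) (sym v≡ufⁿ)) Nv≡1)
      in  k , inj₁ (trans v≡ufⁿ ufⁿ≡uDᵏ)
    classify (n , inj₂ (inj₁ v≡-ufⁿ)) =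
      ⊥-elim (0≤-p⇒p≯0 (subst (0ℚ ≤_) (cong proj₁ v≡-ufⁿ) 0≤v₁)
                        (powK-ratPart-positive D uf (IsFundamentalUnit⇒positive D uf fundamental) n))
    classify (n , inj₂ (inj₂ (inj₁ vufⁿ≡1))) =
      let k , v≡1·conj = conj-of-inverse n oneK vufⁿ≡1 (normK-oneK D)
      in  k , inj₂ (trans v≡1·conj (mulK-identityˡ D (conjK (powK D uD k))))
    classify (n , inj₂ (inj₂ (inj₂ vufⁿ≡-1))) =
      let k , v≡-1·conj = conj-of-inverse n (negK oneK) vufⁿ≡-1 (trans (normK-negK D oneK) (normK-oneK D))
          v₁≡-uDᵏ₁      = trans (cong ratPart v≡-1·conj) (ratPart-mulK-negOneˡ D (conjK (powK D uD k)))
      in  ⊥-elim (0≤-p⇒p≯0 (subst (0ℚ ≤_) v₁≡-uDᵏ₁ 0≤v₁) (powK-ratPart-positive D uD uD-positive k))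

  t²-4≡Dm²⇒ratPart-powK-uD : ∀ t m → ℤ.0ℤ ℤ.≤ t → m ≢ ℤ.0ℤ → t ℤ.* t ℤ.- ℤ.+ 4 ≡ ℤ.+ D ℤ.* (m ℤ.* m) →
                             ∃[ r ] (1 ℕ.≤ r × ℤtoℚ t * ½ ≡ ratPart (powK D uD r))
  t²-4≡Dm²⇒ratPart-powK-uD t m 0≤t m≢0 pell =
    ratPart-powK-or-conjK D (halfK t m) uD v₂≢0 (unit-of-normK≡1 (halfK t m) v-unit Nv≡1 0≤v₁)
    where
    Nv≡1 : normK D (halfK t m) ≡ 1ℚ
    Nv≡1 = normK-halfK D t m pell
    v-unit : IsUnit D (halfK t m)
    v-unit = normK≡1⇒IsUnit D (ℤtoℚ t * ½) (ℤtoℚ m * ½) (t , p*½+p*½≡p (ℤtoℚ t)) Nv≡1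
    0≤v₁ : 0ℚ ≤ ℤtoℚ t * ½
    0≤v₁ = nonNeg*nonNeg (ℤtoℚ-mono-≤ {ℤ.0ℤ} {t} 0≤t) (ℚP.<⇒≤ (ℚP.positive⁻¹ ½))
    v₂≢0 : ℤtoℚ m * ½ ≢ 0ℚ
    v₂≢0 m/2≡0 = m≢0 (ℤtoℚ-injective {m} {ℤ.0ℤ} (trans (sym (p*½+p*½≡p (ℤtoℚ m))) (cong (λ x → x + x) m/2≡0)))

  ratPart-powK-uD⇒squareFreePart : SquareFreeℤ (ℤ.+ D) → ∀ r t → ℤtoℚ t * ½ ≡ ratPart (powK D uD (suc r)) →
                                   ℤ.0ℤ ℤ.< t × SquareFreePartIs (t ℤ.* t ℤ.- ℤ.+ 4) (ℤ.+ D)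
  ratPart-powK-uD⇒squareFreePart sqf r t t/2≡a = 0<t , squareFreePart-of-normK≡1 D a b t sqf Nx≡1 0<b t≡2a
    where
    a b : ℚ
    a = ratPart (powK D uD (suc r))
    b = proj₂ (powK D uD (suc r))
    Nx≡1 : normK D (a , b) ≡ 1ℚ
    Nx≡1 = normK-powK D uD NuD≡1 (suc r)
    0<a×0<b : PositiveCoefficients (a , b)
    0<a×0<b = powK-positive D {uD} uD-positive r
    0<b : 0ℚ < b
    0<b = proj₂ 0<a×0<b
    t≡2a : ℤtoℚ t ≡ a + a
    t≡2a = trans (sym (p*½+p*½≡p (ℤtoℚ t))) (cong₂ _+_ t/2≡a t/2≡a)
    0<t : ℤ.0ℤ ℤ.< t
    0<t = ℤtoℚ-cancel-< {ℤ.0ℤ} {t} (subst (0ℚ <_) (sym t≡2a) (ℚP.+-mono-< (proj₁ 0<a×0<b) (proj₁ 0<a×0<b)))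

lemma1 : (D : ℕ) → 2 ℕ.≤ D → SquareFreeℤ (ℤ.+ D) →
         (uf uD : K) → IsFundamentalUnit D uf → IsUD D uf uD →
         (d : ℤ) →
         ((ℤ.0ℤ ℤ.< d × SquareFreePartIs ((d ℤ.- ℤ.1ℤ) ℤ.* (d ℤ.- ℤ.1ℤ) ℤ.- ℤ.+ 4) (ℤ.+ D))
          ⇔ (∃[ r ] (1 ℕ.≤ r × ℤtoℚ (d ℤ.- ℤ.1ℤ) ℚ.* ½ ≡ ratPart (powK D uD r))))
lemma1 D _ sqf uf uD fundamental ud d = mk⇔ forward backward
  where
  t : ℤ
  t = d ℤ.- ℤ.1ℤ

  forward : ℤ.0ℤ ℤ.< d × SquareFreePartIs (t ℤ.* t ℤ.- ℤ.+ 4) (ℤ.+ D) →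
            ∃[ r ] (1 ℕ.≤ r × ℤtoℚ t * ½ ≡ ratPart (powK D uD r))
  forward (0<d , _ , m , m≢0 , pell) =
    t²-4≡Dm²⇒ratPart-powK-uD D uf uD fundamental ud t m (0<d⇒0≤d-1 0<d) m≢0 pell

  backward : ∃[ r ] (1 ℕ.≤ r × ℤtoℚ t * ½ ≡ ratPart (powK D uD r)) →
             ℤ.0ℤ ℤ.< d × SquareFreePartIs (t ℤ.* t ℤ.- ℤ.+ 4) (ℤ.+ D)
  backward (suc r , _ , t/2≡a) =
    let 0<t , squareFreePart = ratPart-powK-uD⇒squareFreePart D uf uD fundamental ud sqf r t t/2≡a
    in  0<d-1⇒0<d 0<t , squareFreePart
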